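{- Let $V$ be a finite totally ordered set and let $w$ be a derangement (fixed-point-free permutation) of $V$. Then: (a) For distinct $t, t' \in U(w)$, the sets $E_{w,t}$ and $E_{w,t'}$ are disjoint. (b) If $s \in V$ is minimal in its $w$-cycle, then $E_{w,w(s)} \subseteq E_{w,s}$.
   Context: For a permutation $w$ of a finite totally ordered set $V$ and $t \in V$, define $\rho_w(t) = \{t, w(t), \ldots, w^{k-1}(t)\}$, where $k$ is the smallest positive integer with $w^k(t) \le t$, and define $\lambda_w(t) = w^{ -\ell}(t)$, where $\ell$ is the smallest positive integer with $w^{ -\ell}(t) \le t$. Define $E_{w,t} = \{\{\lambda_w(t), s\} : s \in \rho_w(t)\}$, a set of (potential) edges, i.e. $2$-element subsets of $V$ (when $t$ is minimal in its cycle, $\lambda_w(t)=t$ and the element $s=t$ contributes no genuine pair). $U(w)$ denotes the set of elements of $V$ that are not the minimal element of their $w$-cycle. -}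

module Defs where

open import Data.Nat using (ℕ; zero; suc) renaming (_≤_ to _≤ℕ_; _<_ to _<ℕ_)
open import Data.Fin using (Fin; _≤_; _<_)
open import Data.Fin.Permutation using (Permutation′; _⟨$⟩ʳ_; _⟨$⟩ˡ_)
open import Data.Product using (Σ; _×_; ∃; ∃-syntax)
open import Data.Sum using (_⊎_)
open import Relation.Binary.PropositionalEquality using (_≡_; _≢_)

-- V is modelled as Fin n with its natural total order.

iter : ∀ {A : Set} → (A → A) → ℕ → A → A
iter f zero    x = x
iter f (suc j) x = f (iter f j x)

module _ {n : ℕ} (w : Permutation′ n) where

  pow : ℕ → Fin n → Fin n
  pow j = iter (w ⟨$⟩ʳ_) j

  powInv : ℕ → Fin n → Fin n
  powInv j = iter (w ⟨$⟩ˡ_) j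

  Derangement : Set
  Derangement = ∀ x → w ⟨$⟩ʳ x ≢ x

  MinInCycle : Fin n → Set
  MinInCycle t = ∀ j → t ≤ pow j t

  InU : Fin n → Set
  InU t = ∃[ j ] pow j t < t

  -- s ∈ ρ_w(t) = {t, w t, …, w^{k-1} t}, k least positive with w^k t ≤ t.
  -- Equivalently s = w^j t for some j with w^i t > t for all 1 ≤ i ≤ j
  -- (i.e. j < k).
  InRho : Fin n → Fin n → Set
  InRho t s = ∃[ j ] (s ≡ pow j t × (∀ i → 1 ≤ℕ i → i ≤ℕ j → t < pow i t))

  IsLambda : Fin n → Fin n → Set
  IsLambda t u = ∃[ ℓ ] (1 ≤ℕ ℓ × u ≡ powInv ℓ t × u ≤ t
                         × (∀ i → 1 ≤ℕ i → i <ℕ ℓ → t < powInv i t))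

  InE : Fin n → Fin n → Fin n → Set
  InE t a b = a ≢ b × ∃[ u ] (IsLambda t u × ∃[ s ] (InRho t s ×
                ((a ≡ u × b ≡ s) ⊎ (a ≡ s × b ≡ u))))

module Submission where

-- For (a) an edge {λ(t), s} of E_{w,t} is read forwards as a "climb": starting
-- at u = λ(t) one reaches t after ℓ ≥ 1 steps and s after len ≥ ℓ steps, every
-- point strictly after u being ≥ t.  Since u ≤ t ≤ s, the edge determines u and
-- s.  Two climbs from u to s towards t and t′ must have the same length: if the
-- second were longer, u would recur inside it, forcing u = t′ and making t′
-- minimal in its cycle (a periodic point lying below its whole period is
-- minimal), contradicting t′ ∈ U(w).  With equal lengths, the climb arriving
-- later at its target would pass above it, so ℓ = ℓ′ and t = t′.
--
-- For (b): λ(w s) = s because one step back from w s reaches s < w s; λ(s) = s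
-- because s is minimal (its least backward period gives the witness); and
-- ρ(w s) ⊆ ρ(s) because the walk from s just prepends the step s → w s.

open import Defs
open import Data.Nat using (ℕ)
open import Data.Fin using (Fin)
open import Data.Fin.Permutation using (Permutation′; _⟨$⟩ʳ_)
open import Data.Product using (_×_)
open import Data.Empty using (⊥)
open import Relation.Binary.PropositionalEquality using (_≢_)

open import Data.Nat
  using (zero; suc; _+_; _∸_; _*_; _%_; _/_; z≤n; s≤s; NonZero; >-nonZero)
  renaming (_≤_ to _≤ℕ_; _<_ to _<ℕ_)
import Data.Nat.Properties as ℕₚ
open import Data.Nat.DivMod using (m≡m%n+[m/n]*n; m%n<n)
open import Data.Fin using (_≤_; _<_; toℕ)
import Data.Fin.Properties as Finₚ
open import Data.Fin.Permutation using (_⟨$⟩ˡ_; inverseˡ; inverseʳ)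
open import Data.Product using (_,_; ∃-syntax)
open import Data.Sum using (_⊎_; inj₁; inj₂)
open import Data.Empty using (⊥-elim)
open import Function using (_∘_)
open import Relation.Nullary using (Dec; yes; no; ¬_)
open import Relation.Binary using (tri<; tri≈; tri>)
open import Relation.Binary.PropositionalEquality
  using (_≡_; refl; sym; trans; cong; subst; module ≡-Reasoning)

iter-+ : ∀ {A : Set} (f : A → A) m k x → iter f (m + k) x ≡ iter f m (iter f k x)
iter-+ f zero    k x = refl
iter-+ f (suc m) k x = cong f (iter-+ f m k x)

iter-comm : ∀ {A : Set} (f : A → A) k x → iter f k (f x) ≡ f (iter f k x)
iter-comm f zero    x = refl
iter-comm f (suc k) x = cong f (iter-comm f k x)

iter-cancel : ∀ {A : Set} (f g : A → A) → (∀ x → g (f x) ≡ x) →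
              ∀ k x → iter g k (iter f k x) ≡ x
iter-cancel f g gf zero    x = refl
iter-cancel f g gf (suc k) x = begin
  g (iter g k (f (iter f k x)))  ≡⟨ iter-comm g k _ ⟨
  iter g k (g (f (iter f k x)))  ≡⟨ cong (iter g k) (gf _) ⟩
  iter g k (iter f k x)          ≡⟨ iter-cancel f g gf k x ⟩
  x                              ∎
  where open ≡-Reasoning

iter-injective : ∀ {A : Set} (f g : A → A) → (∀ x → g (f x) ≡ x) →
                 ∀ k {x y} → iter f k x ≡ iter f k y → x ≡ y
iter-injective f g gf k {x} {y} e =
  trans (sym (iter-cancel f g gf k x)) (trans (cong (iter g k) e) (iter-cancel f g gf k y))

least-witness : ∀ {P : ℕ → Set} → (∀ k → Dec (P k)) → ∀ N → P N →
                ∃[ m ] (P m × (∀ k → k <ℕ m → ¬ P k))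
least-witness P? N pN with P? zero
... | yes p₀ = zero , p₀ , λ _ ()
least-witness P? zero    p₀ | no ¬p₀ = ⊥-elim (¬p₀ p₀)
least-witness {P} P? (suc N) pN | no ¬p₀
  with m , pm , below ← least-witness {P ∘ suc} (P? ∘ suc) N pN
  = suc m , pm , λ { zero _ → ¬p₀ ; (suc k) (s≤s k<m) → below k k<m }

ordered-pair-unique : ∀ {n} {a b u s u′ s′ : Fin n} → a ≢ b → u ≤ s → u′ ≤ s′ →
                      (a ≡ u × b ≡ s) ⊎ (a ≡ s × b ≡ u) →
                      (a ≡ u′ × b ≡ s′) ⊎ (a ≡ s′ × b ≡ u′) →
                      u ≡ u′ × s ≡ s′
ordered-pair-unique _   _   _    (inj₁ (refl , refl)) (inj₁ (p , q))       = p , q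
ordered-pair-unique _   _   _    (inj₂ (refl , refl)) (inj₂ (p , q))       = q , p
ordered-pair-unique a≢b u≤s u′≤s′ (inj₁ (refl , refl)) (inj₂ (refl , refl)) =
  ⊥-elim (a≢b (Finₚ.≤-antisym u≤s u′≤s′))
ordered-pair-unique a≢b u≤s u′≤s′ (inj₂ (refl , refl)) (inj₁ (refl , refl)) =
  ⊥-elim (a≢b (Finₚ.≤-antisym u′≤s′ u≤s))

module Orbits {n : ℕ} (w : Permutation′ n) where

  W W⁻¹ : Fin n → Fin n
  W   x = w ⟨$⟩ʳ x
  W⁻¹ x = w ⟨$⟩ˡ x

  pow-+ : ∀ m k x → pow w (m + k) x ≡ pow w m (pow w k x)
  pow-+ = iter-+ W

  pow-injective : ∀ k {x y} → pow w k x ≡ pow w k y → x ≡ y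
  pow-injective = iter-injective W W⁻¹ (λ _ → inverseˡ w)

  powInv-injective : ∀ k {x y} → powInv w k x ≡ powInv w k y → x ≡ y
  powInv-injective = iter-injective W⁻¹ W (λ _ → inverseʳ w)

  pow-powInv : ∀ {k ℓ} x → k ≤ℕ ℓ → pow w k (powInv w ℓ x) ≡ powInv w (ℓ ∸ k) x
  pow-powInv {k} {ℓ} x k≤ℓ = begin
    pow w k (powInv w ℓ x)
      ≡⟨ cong (λ m → pow w k (powInv w m x)) (ℕₚ.m+[n∸m]≡n k≤ℓ) ⟨
    pow w k (powInv w (k + (ℓ ∸ k)) x)
      ≡⟨ cong (pow w k) (iter-+ W⁻¹ k (ℓ ∸ k) x) ⟩
    pow w k (powInv w k (powInv w (ℓ ∸ k) x))
      ≡⟨ iter-cancel W⁻¹ W (λ _ → inverseʳ w) k _ ⟩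
    powInv w (ℓ ∸ k) x ∎
    where open ≡-Reasoning

  -- Every point has a positive backward period (pigeonhole on x, w⁻¹x, …, w⁻ⁿx).
  inverse-period : ∀ x → ∃[ P ] (1 ≤ℕ P × powInv w P x ≡ x)
  inverse-period x
    with i , j , i<j , eq ← Finₚ.pigeonhole (ℕₚ.n<1+n n) (λ k → powInv w (toℕ k) x)
    = toℕ j ∸ toℕ i , ℕₚ.m<n⇒0<n∸m i<j , powInv-injective (toℕ i) (begin
        powInv w (toℕ i) (powInv w (toℕ j ∸ toℕ i) x)
          ≡⟨ iter-+ W⁻¹ (toℕ i) _ x ⟨
        powInv w (toℕ i + (toℕ j ∸ toℕ i)) x
          ≡⟨ cong (λ m → powInv w m x) (ℕₚ.m+[n∸m]≡n (ℕₚ.<⇒≤ i<j)) ⟩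
        powInv w (toℕ j) x
          ≡⟨ eq ⟨
        powInv w (toℕ i) x ∎)
    where open ≡-Reasoning

  -- A point of period P lying below its first P iterates is minimal in its
  -- cycle, since every iterate w^j x equals w^(j mod P) x.
  periodic-minimal : ∀ {x} P .{{_ : NonZero P}} → pow w P x ≡ x →
                     (∀ k → 1 ≤ℕ k → k ≤ℕ P → x ≤ pow w k x) → MinInCycle w x
  periodic-minimal {x} P per below j =
    subst (x ≤_) (sym pow-mod) (residue (j % P) (m%n<n j P))
    where
    pow-multiple : ∀ q → pow w (q * P) x ≡ x
    pow-multiple zero    = refl
    pow-multiple (suc q) =
      trans (pow-+ P (q * P) x) (trans (cong (pow w P) (pow-multiple q)) per)

    pow-mod : pow w j x ≡ pow w (j % P) x
    pow-mod = begin
      pow w j x                                 ≡⟨ cong (λ m → pow w m x) (m≡m%n+[m/n]*n j P) ⟩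
      pow w (j % P + (j / P) * P) x             ≡⟨ pow-+ (j % P) _ x ⟩
      pow w (j % P) (pow w ((j / P) * P) x)     ≡⟨ cong (pow w (j % P)) (pow-multiple (j / P)) ⟩
      pow w (j % P) x                           ∎
      where open ≡-Reasoning

    residue : ∀ r → r <ℕ P → x ≤ pow w r x
    residue zero    _   = ℕₚ.≤-refl
    residue (suc r) r<P = below (suc r) (s≤s z≤n) (ℕₚ.<⇒≤ r<P)

  rho-above : ∀ {t j} → (∀ i → 1 ≤ℕ i → i ≤ℕ j → t < pow w i t) →
              ∀ i → i ≤ℕ j → t ≤ pow w i t
  rho-above ρ zero    _   = ℕₚ.≤-refl
  rho-above ρ (suc i) i≤j = ℕₚ.<⇒≤ (ρ (suc i) (s≤s z≤n) i≤j)

  -- Forward reading of an edge {u, s} of E_{w,t} with u = λ(t), s ∈ ρ(t):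
  -- from u, the walk reaches t after ℓ steps and s after len steps, passing
  -- strictly above t before t and staying at or above t throughout.
  record Climb (t u s : Fin n) : Set where
    field
      ℓ len    : ℕ
      1≤ℓ      : 1 ≤ℕ ℓ
      ℓ≤len    : ℓ ≤ℕ len
      u≤t      : u ≤ t
      to-t     : pow w ℓ u ≡ t
      to-s     : pow w len u ≡ s
      before-t : ∀ k → 1 ≤ℕ k → k <ℕ ℓ → t < pow w k u
      above    : ∀ k → 1 ≤ℕ k → k ≤ℕ len → t ≤ pow w k u
  open Climb

  climb : ∀ {t u s} → IsLambda w t u → InRho w t s → Climb t u s
  climb {t} (ℓ , 1≤ℓ , refl , u≤t , beyond) (j , refl , ρ) = record
    { ℓ = ℓ ; len = j + ℓ ; 1≤ℓ = 1≤ℓ ; ℓ≤len = ℕₚ.m≤n+m ℓ j ; u≤t = u≤t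
    ; to-t = arrive ; to-s = trans (pow-+ j ℓ u) (cong (pow w j) arrive)
    ; before-t = before ; above = above′ }
    where
    u = powInv w ℓ t

    arrive : pow w ℓ u ≡ t
    arrive = trans (pow-powInv {k = ℓ} t ℕₚ.≤-refl) (cong (λ m → powInv w m t) (ℕₚ.n∸n≡0 ℓ))

    before : ∀ k → 1 ≤ℕ k → k <ℕ ℓ → t < pow w k u
    before k 1≤k k<ℓ = subst (t <_) (sym (pow-powInv t (ℕₚ.<⇒≤ k<ℓ)))
      (beyond (ℓ ∸ k) (ℕₚ.m<n⇒0<n∸m k<ℓ) (ℕₚ.∸-monoʳ-< 1≤k (ℕₚ.<⇒≤ k<ℓ)))

    above′ : ∀ k → 1 ≤ℕ k → k ≤ℕ j + ℓ → t ≤ pow w k u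
    above′ k 1≤k k≤len with k ℕₚ.<? ℓ
    ... | yes k<ℓ = ℕₚ.<⇒≤ (before k 1≤k k<ℓ)
    ... | no  k≮ℓ = subst (t ≤_) (sym after-t)
      (rho-above ρ (k ∸ ℓ) (ℕₚ.m≤n+o⇒m∸n≤o k ℓ (subst (k ≤ℕ_) (ℕₚ.+-comm j ℓ) k≤len)))
      where
      after-t : pow w k u ≡ pow w (k ∸ ℓ) t
      after-t = trans (cong (λ m → pow w m u) (sym (ℕₚ.m∸n+n≡m (ℕₚ.≮⇒≥ k≮ℓ))))
                      (trans (pow-+ (k ∸ ℓ) ℓ u) (cong (pow w (k ∸ ℓ)) arrive))

  climb-ordered : ∀ {t u s} → Climb t u s → u ≤ s
  climb-ordered c = Finₚ.≤-trans (u≤t c)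
    (subst (_ ≤_) (to-s c) (above c (len c) (ℕₚ.≤-trans (1≤ℓ c) (ℓ≤len c)) ℕₚ.≤-refl))

  -- A climb towards t′ ∈ U(w) cannot be longer than another climb with the
  -- same ends: u would recur within it, so u = t′ and t′ would be minimal.
  longer-climb-impossible : ∀ {t t′ u s} → InU w t′ → (c : Climb t u s) (c′ : Climb t′ u s) →
                            len c <ℕ len c′ → ⊥
  longer-climb-impossible {t′ = t′} {u} (j , below) c c′ lt =
    ℕₚ.<⇒≱ below (subst (MinInCycle w) u≡t′ u-minimal j)
    where
    open ≡-Reasoning
    P = len c′ ∸ len c
    1≤P : 1 ≤ℕ P
    1≤P = ℕₚ.m<n⇒0<n∸m lt
    P≤len′ : P ≤ℕ len c′
    P≤len′ = ℕₚ.m∸n≤m (len c′) (len c)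

    u-periodic : pow w P u ≡ u
    u-periodic = pow-injective (len c) (begin
      pow w (len c) (pow w P u)  ≡⟨ pow-+ (len c) P u ⟨
      pow w (len c + P) u        ≡⟨ cong (λ m → pow w m u) (ℕₚ.m+[n∸m]≡n (ℕₚ.<⇒≤ lt)) ⟩
      pow w (len c′) u           ≡⟨ trans (to-s c′) (sym (to-s c)) ⟩
      pow w (len c) u            ∎)

    u≡t′ : u ≡ t′
    u≡t′ = Finₚ.≤-antisym (u≤t c′) (subst (t′ ≤_) u-periodic (above c′ P 1≤P P≤len′))

    u-minimal : MinInCycle w u
    u-minimal = periodic-minimal P {{>-nonZero 1≤P}} u-periodic λ k 1≤k k≤P →
      subst (_≤ pow w k u) (sym u≡t′) (above c′ k 1≤k (ℕₚ.≤-trans k≤P P≤len′))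

  -- Of two climbs from u, the one reaching its target later passes above
  -- the earlier target, while the earlier target lies above the later one.
  later-arrival-impossible : ∀ {t t′ u s} (c : Climb t u s) (c′ : Climb t′ u s) →
                             len c′ ≤ℕ len c → ℓ c <ℕ ℓ c′ → ⊥
  later-arrival-impossible {t} {t′} c c′ len′≤len lt = ℕₚ.<⇒≱ t′<t t≤t′
    where
    t′<t : t′ < t
    t′<t = subst (t′ <_) (to-t c) (before-t c′ (ℓ c) (1≤ℓ c) lt)
    t≤t′ : t ≤ t′
    t≤t′ = subst (t ≤_) (to-t c′)
      (above c (ℓ c′) (1≤ℓ c′) (ℕₚ.≤-trans (ℓ≤len c′) len′≤len))

  climbs-share-target : ∀ {t t′ u s} → InU w t → InU w t′ →
                        Climb t u s → Climb t′ u s → t ≡ t′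
  climbs-share-target {u = u} iu iu′ c c′ with ℕₚ.<-cmp (len c) (len c′)
  ... | tri< lt _ _ = ⊥-elim (longer-climb-impossible iu′ c c′ lt)
  ... | tri> _ _ gt = ⊥-elim (longer-climb-impossible iu c′ c gt)
  ... | tri≈ _ eq _ with ℕₚ.<-cmp (ℓ c) (ℓ c′)
  ...   | tri< lt _ _ = ⊥-elim (later-arrival-impossible c c′ (ℕₚ.≤-reflexive (sym eq)) lt)
  ...   | tri> _ _ gt = ⊥-elim (later-arrival-impossible c′ c (ℕₚ.≤-reflexive eq) gt)
  ...   | tri≈ _ eqℓ _ = trans (sym (to-t c)) (trans (cong (λ m → pow w m u) eqℓ) (to-t c′))

  edge-sets-disjoint : (t t′ : Fin n) → InU w t → InU w t′ → t ≢ t′ →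
                       (a b : Fin n) → InE w t a b → InE w t′ a b → ⊥
  edge-sets-disjoint t t′ iu iu′ t≢t′ a b
    (a≢b , u , λt , s , ρt , pair) (_ , u′ , λt′ , s′ , ρt′ , pair′)
    with refl , refl ← ordered-pair-unique a≢b (climb-ordered (climb λt ρt))
                         (climb-ordered (climb λt′ ρt′)) pair pair′
    = t≢t′ (climbs-share-target iu iu′ (climb λt ρt) (climb λt′ ρt′))

  -- If s is minimal in its cycle then λ(w s) = s: one step back from w s
  -- already reaches s ≤ w s.
  lambda-of-successor : ∀ {s u} → MinInCycle w s → IsLambda w (W s) u → u ≡ s
  lambda-of-successor min (suc zero , _ , refl , _ , _) = inverseˡ w
  lambda-of-successor {s} min (suc (suc ℓ) , _ , _ , _ , beyond) =
    ⊥-elim (ℕₚ.<⇒≱ (subst (W s <_) (inverseˡ w) (beyond 1 ℕₚ.≤-refl (s≤s (s≤s z≤n)))) (min 1))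

  -- A minimal point is its own λ: the witness is its least backward period,
  -- before which every backward iterate differs from, hence exceeds, it.
  lambda-of-minimal : ∀ {s} → MinInCycle w s → IsLambda w s s
  lambda-of-minimal {s} min
    with suc p , _ , per ← inverse-period s
    with m , per-m , aperiodic ← least-witness (λ k → powInv w (suc k) s Finₚ.≟ s) p per
    = suc m , s≤s z≤n , sym per-m , ℕₚ.≤-refl , exceeds
    where
    exceeds : ∀ i → 1 ≤ℕ i → i <ℕ suc m → s < powInv w i s
    exceeds (suc k) _ (s≤s k<m) = Finₚ.≤∧≢⇒< (subst (s ≤_) as-forward (min (m ∸ k)))
                                              (aperiodic k k<m ∘ sym)
      where
      as-forward : pow w (suc m ∸ suc k) s ≡ powInv w (suc k) s
      as-forward = begin
        pow w (suc m ∸ suc k) s                        ≡⟨ cong (pow w (suc m ∸ suc k)) per-m ⟨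
        pow w (suc m ∸ suc k) (powInv w (suc m) s)     ≡⟨ pow-powInv s (ℕₚ.m∸n≤m (suc m) (suc k)) ⟩
        powInv w (suc m ∸ (suc m ∸ suc k)) s           ≡⟨ cong (λ r → powInv w r s) (ℕₚ.m∸[m∸n]≡n (s≤s (ℕₚ.<⇒≤ k<m))) ⟩
        powInv w (suc k) s                             ∎
        where open ≡-Reasoning

  -- If s < w s then ρ(w s) ⊆ ρ(s): the walk from s is the walk from w s
  -- preceded by the step s → w s.
  rho-of-successor : ∀ {s x} → s < W s → InRho w (W s) x → InRho w s x
  rho-of-successor {s} s<Ws (j , refl , ρ) = suc j , iter-comm W j s , climbing
    where
    climbing : ∀ i → 1 ≤ℕ i → i ≤ℕ suc j → s < pow w i s
    climbing (suc zero)    _ _         = s<Ws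
    climbing (suc (suc i)) _ (s≤s i<j) = Finₚ.<-trans s<Ws
      (subst (W s <_) (iter-comm W (suc i) s) (ρ (suc i) (s≤s z≤n) i<j))

  edge-set-inclusion : Derangement w → (s : Fin n) → MinInCycle w s →
                       (a b : Fin n) → InE w (W s) a b → InE w s a b
  edge-set-inclusion der s min a b (a≢b , u , λWs , x , ρWs , pair)
    with refl ← lambda-of-successor min λWs
    = a≢b , s , lambda-of-minimal min , x , rho-of-successor s<Ws ρWs , pair
    where
    s<Ws : s < W s
    s<Ws = Finₚ.≤∧≢⇒< (min 1) (der s ∘ sym)

lemma3p4 : (n : ℕ) (w : Permutation′ n) → Derangement w →
    ((t t′ : Fin n) → InU w t → InU w t′ → t ≢ t′ →
      (a b : Fin n) → InE w t a b → InE w t′ a b → ⊥)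
    × ((s : Fin n) → MinInCycle w s →
      (a b : Fin n) → InE w (w ⟨$⟩ʳ s) a b → InE w s a b)
lemma3p4 n w der = Orbits.edge-sets-disjoint w , Orbits.edge-set-inclusion w der
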